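{- Let $G$ be a complete $q$-partite graph of order $n$ with $q \geq 2$, and let $k$ be a positive integer. Then \[ \mathrm{MOF}_k(G) \geq n - k(q - 1). \]
   Context: A complete $q$-partite graph has its vertex set partitioned into $q\ge 2$ independent sets (parts), with every edge between vertices in different parts present. An orientation of $G$ assigns to each edge $\{u,v\}$ exactly one of the arcs $(u,v)$ or $(v,u)$; if $(u,v)$ is an arc, $v$ is an out-neighbor of $u$. Oriented $k$-forcing: given an orientation $D$ and a set $S$ of initially colored vertices, any colored vertex having at most $k$ non-colored out-neighbors forces all of them to become colored; this rule is applied iteratively as long as possible. $S$ is an oriented $k$-forcing set if at the end every vertex is colored. $F_k(D)$ is the minimum size of such a set, and $\mathrm{MOF}_k(G)$ is the maximum of $F_k(D)$ over all orientations $D$ of $G$. -}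

module Defs where

open import Data.Nat using (ℕ; _≤_)
open import Data.Bool using (Bool; true; false; T)
open import Data.Fin using (Fin)
open import Data.Fin.Subset using (Subset; _∈_; _∪_; _∩_; ∁; ∣_∣; ⊤)
open import Data.Vec using (tabulate)
open import Data.Product using (Σ; _×_; ∃)
open import Data.Sum using (_⊎_)
import Data.Empty
open import Function using (Surjective)
open import Relation.Binary.PropositionalEquality using (_≡_; _≢_)
open import Relation.Binary.Construct.Closure.ReflexiveTransitive using (Star)

-- A complete q-partite graph on vertex set Fin n is given by a part
-- assignment  part : Fin n → Fin q  which is surjective (every part is a
-- nonempty independent set).
record CompleteMultipartite (n q : ℕ) : Set where
  field
    part     : Fin n → Fin q
    part-surj : Surjective _≡_ _≡_ part

open CompleteMultipartite public

Adj : ∀ {n q} → CompleteMultipartite n q → Fin n → Fin n → Set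
Adj G u v = part G u ≢ part G v

record Orientation {n q : ℕ} (G : CompleteMultipartite n q) : Set where
  field
    arc       : Fin n → Fin n → Bool
    arc-edge  : ∀ u v → T (arc u v) → Adj G u v
    arc-total : ∀ u v → Adj G u v → T (arc u v) ⊎ T (arc v u)
    arc-anti  : ∀ u v → T (arc u v) → T (arc v u) → Data.Empty.⊥

open Orientation public

outN : ∀ {n q} {G : CompleteMultipartite n q} → Orientation G → Fin n → Subset n
outN D v = tabulate (λ w → arc D v w)

ForceStep : ∀ {n q} {G : CompleteMultipartite n q} → Orientation G → ℕ →
            Subset n → Subset n → Set
ForceStep {n} D k S S' =
  Σ (Fin n) λ v → v ∈ S × ∣ ∁ S ∩ outN D v ∣ ≤ k × S' ≡ S ∪ (∁ S ∩ outN D v)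

-- S is an oriented k-forcing set of D: iterating the forcing rule can color
-- every vertex (the final colored set is unique since the rule is monotone).
IsForcingSet : ∀ {n q} {G : CompleteMultipartite n q} → Orientation G → ℕ →
               Subset n → Set
IsForcingSet D k S = Star (ForceStep D k) S ⊤

module Submission where

-- Number the parts 0, 1, …, q-1 and orient every edge from the
-- part with the smaller number to the part with the larger one; call the
-- part number of a vertex its level.  An out-neighbour of v then always has
-- a strictly larger level than v.
--
-- Along any forcing run we track a threshold t such that every vertex of
-- level > t is already colored, together with the potential |S| + k·t.
-- A step that colors nothing keeps the potential.  A step in which v colors
-- at least one (necessarily uncolored, hence level ≤ t) vertex has
-- level v < t; it colors at most k vertices, after it every vertex above
-- level v is colored, so the threshold may drop to level v and the potential
-- does not increase.  A run ending with every vertex colored therefore gives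
-- n ≤ |S| + k·t for the initial threshold, and t = q-1 is valid for any S.

open import Defs
open import Data.Nat using (ℕ; suc; _≤_; _<_; _≥_; _+_; _*_; _∸_; _<ᵇ_; z≤n; s≤s)
open import Data.Nat.Properties
open import Data.Bool using (Bool; true; false; T)
open import Data.Bool.Properties using (T-≡)
open import Data.Fin using (Fin; toℕ)
open import Data.Fin.Properties using (toℕ-injective; toℕ≤pred[n])
open import Data.Fin.Subset using (Subset; ∣_∣; _∈_; _∪_; _∩_; ∁; ⊤)
open import Data.Fin.Subset.Properties
  using (_∈?_; x∈p∪q⁺; x∈p∩q⁻; x∈p∩q⁺; x∈∁p⇒x∉p; x∉p⇒x∈∁p; nonempty?; Empty-unique; ∪-identityʳ; ∣⊤∣≡n)
open import Data.Vec using ([]; _∷_; tabulate)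
open import Data.Vec.Properties using (lookup∘tabulate; []=⇒lookup; lookup⇒[]=)
open import Data.Product using (Σ; _,_; _×_; proj₁; proj₂)
open import Data.Sum using (_⊎_; inj₁; inj₂)
open import Data.Empty using (⊥-elim)
open import Function using (_⇔_; mk⇔)
open import Function.Bundles using (module Equivalence)
open import Relation.Nullary using (yes; no)
open import Relation.Binary using (tri<; tri≈; tri>)
open import Relation.Binary.PropositionalEquality using (_≡_; refl; sym; trans; cong)
open import Relation.Binary.Construct.Closure.ReflexiveTransitive using (Star; ε; _◅_)

∣p∪q∣≤∣p∣+∣q∣ : ∀ {n} (p q : Subset n) → ∣ p ∪ q ∣ ≤ ∣ p ∣ + ∣ q ∣
∣p∪q∣≤∣p∣+∣q∣ []          []          = z≤n
∣p∪q∣≤∣p∣+∣q∣ (true ∷ p)  (true ∷ q)  =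
  s≤s (≤-trans (m≤n⇒m≤1+n (∣p∪q∣≤∣p∣+∣q∣ p q)) (≤-reflexive (sym (+-suc ∣ p ∣ ∣ q ∣))))
∣p∪q∣≤∣p∣+∣q∣ (true ∷ p)  (false ∷ q) = s≤s (∣p∪q∣≤∣p∣+∣q∣ p q)
∣p∪q∣≤∣p∣+∣q∣ (false ∷ p) (true ∷ q)  =
  ≤-trans (s≤s (∣p∪q∣≤∣p∣+∣q∣ p q)) (≤-reflexive (sym (+-suc ∣ p ∣ ∣ q ∣)))
∣p∪q∣≤∣p∣+∣q∣ (false ∷ p) (false ∷ q) = ∣p∪q∣≤∣p∣+∣q∣ p q

∈-tabulate : ∀ {n} (f : Fin n → Bool) (x : Fin n) → x ∈ tabulate f ⇔ T (f x)
∈-tabulate f x = mk⇔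
  (λ x∈ → Equivalence.from T-≡ (trans (sym (lookup∘tabulate f x)) ([]=⇒lookup x∈)))
  (λ fx → lookup⇒[]= x (tabulate f) (trans (lookup∘tabulate f x) (Equivalence.to T-≡ fx)))

module _ {n q : ℕ} (G : CompleteMultipartite n q) where

  level : Fin n → ℕ
  level u = toℕ (part G u)

  levelOrientation : Orientation G
  levelOrientation = record
    { arc       = λ u v → level u <ᵇ level v
    ; arc-edge  = λ u v uv same → <-irrefl (cong toℕ same) (<ᵇ⇒< (level u) (level v) uv)
    ; arc-total = total
    ; arc-anti  = λ u v uv vu → <-asym (<ᵇ⇒< (level u) (level v) uv) (<ᵇ⇒< (level v) (level u) vu)
    }
    where
    total : ∀ u v → Adj G u v → T (level u <ᵇ level v) ⊎ T (level v <ᵇ level u)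
    total u v different-parts with <-cmp (level u) (level v)
    ... | tri< u<v _ _ = inj₁ (<⇒<ᵇ u<v)
    ... | tri≈ _ u≡v _ = ⊥-elim (different-parts (toℕ-injective u≡v))
    ... | tri> _ _ v<u = inj₂ (<⇒<ᵇ v<u)

  outN⇔higher : ∀ v u → u ∈ outN levelOrientation v ⇔ level v < level u
  outN⇔higher v u = mk⇔
    (λ u∈ → <ᵇ⇒< (level v) (level u) (Equivalence.to (∈-tabulate _ u) u∈))
    (λ v<u → Equivalence.from (∈-tabulate _ u) (<⇒<ᵇ v<u))

  forced : Subset n → Fin n → Subset n
  forced S v = ∁ S ∩ outN levelOrientation v

  ColoredAbove : Subset n → ℕ → Set
  ColoredAbove S t = ∀ u → t < level u → u ∈ S

  coloredAbove-∪ : ∀ {S t} X → ColoredAbove S t → ColoredAbove (S ∪ X) t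
  coloredAbove-∪ X above u t<u = x∈p∪q⁺ (inj₁ (above u t<u))

  coloredAbove-afterForcing : ∀ S v → ColoredAbove (S ∪ forced S v) (level v)
  coloredAbove-afterForcing S v u v<u with u ∈? S
  ... | yes u∈S = x∈p∪q⁺ (inj₁ u∈S)
  ... | no  u∉S = x∈p∪q⁺ (inj₂ (x∈p∩q⁺ (x∉p⇒x∈∁p u∉S , Equivalence.from (outN⇔higher v u) v<u)))

  forcer-below : ∀ {S t v w} → ColoredAbove S t → w ∈ forced S v → level v < t
  forcer-below {S} {t} {v} {w} above w∈ = <-≤-trans v<w w≤t
    where
    v<w : level v < level w
    v<w = Equivalence.to (outN⇔higher v w) (proj₂ (x∈p∩q⁻ (∁ S) _ w∈))
    w≤t : level w ≤ t
    w≤t with level w ≤? t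
    ... | yes w≤t = w≤t
    ... | no  w≰t = ⊥-elim (x∈∁p⇒x∉p (proj₁ (x∈p∩q⁻ (∁ S) _ w∈)) (above w (≰⇒> w≰t)))

  forcingStep-potential : ∀ {k S S' t} → ColoredAbove S t → ForceStep levelOrientation k S S' →
    Σ ℕ λ t' → ColoredAbove S' t' × ∣ S' ∣ + k * t' ≤ ∣ S ∣ + k * t
  forcingStep-potential {k} {S} {t = t} above (v , _ , few , refl) with nonempty? (forced S v)
  ... | no nothing-forced = t , coloredAbove-∪ (forced S v) above , +-monoˡ-≤ (k * t) (≤-reflexive same-size)
    where
    same-size : ∣ S ∪ forced S v ∣ ≡ ∣ S ∣
    same-size = cong ∣_∣ (trans (cong (S ∪_) (Empty-unique nothing-forced)) (∪-identityʳ S))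
  ... | yes (w , w∈) = level v , coloredAbove-afterForcing S v , potential-drops
    where
    open ≤-Reasoning
    potential-drops : ∣ S ∪ forced S v ∣ + k * level v ≤ ∣ S ∣ + k * t
    potential-drops = begin
      ∣ S ∪ forced S v ∣ + k * level v       ≤⟨ +-monoˡ-≤ (k * level v) (∣p∪q∣≤∣p∣+∣q∣ S (forced S v)) ⟩
      ∣ S ∣ + ∣ forced S v ∣ + k * level v   ≤⟨ +-monoˡ-≤ (k * level v) (+-monoʳ-≤ ∣ S ∣ few) ⟩
      ∣ S ∣ + k + k * level v                ≡⟨ +-assoc ∣ S ∣ k (k * level v) ⟩
      ∣ S ∣ + (k + k * level v)              ≡⟨ cong (∣ S ∣ +_) (sym (*-suc k (level v))) ⟩
      ∣ S ∣ + k * suc (level v)              ≤⟨ +-monoʳ-≤ ∣ S ∣ (*-monoʳ-≤ k (forcer-below above w∈)) ⟩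
      ∣ S ∣ + k * t                          ∎

  forcingRun-potential : ∀ {k S t} → ColoredAbove S t → Star (ForceStep levelOrientation k) S ⊤ →
    n ≤ ∣ S ∣ + k * t
  forcingRun-potential {k} {t = t} _ ε = ≤-trans (≤-reflexive (sym (∣⊤∣≡n n))) (m≤m+n ∣ ⊤ {n} ∣ (k * t))
  forcingRun-potential above (step ◅ run) with forcingStep-potential above step
  ... | t' , above' , drops = ≤-trans (forcingRun-potential above' run) drops

  coloredAbove-top : ∀ S → ColoredAbove S (q ∸ 1)
  coloredAbove-top S u q-1<u = ⊥-elim (<⇒≱ q-1<u (level≤q-1 (part G u)))
    where
    level≤q-1 : ∀ {m} (i : Fin m) → toℕ i ≤ m ∸ 1
    level≤q-1 {suc m} i = toℕ≤pred[n] i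

corollary13 : (n q k : ℕ) → q ≥ 2 → k ≥ 1 → (G : CompleteMultipartite n q) →
    Σ (Orientation G) λ D → (S : Subset n) → IsForcingSet D k S →
      n ∸ k * (q ∸ 1) ≤ ∣ S ∣
corollary13 n q k _ _ G = levelOrientation G , λ S forcing →
  let n≤S+k[q-1] = forcingRun-potential G (coloredAbove-top G S) forcing
  in m≤n+o⇒m∸n≤o n (k * (q ∸ 1)) (≤-trans n≤S+k[q-1] (≤-reflexive (+-comm ∣ S ∣ (k * (q ∸ 1)))))
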